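{- Let $m,n,s,c$ be positive integers such that $2\leq s\leq n$ and $ms=2n$. An $\mathrm{MRS}(m,n;s,2;c)$ exists if and only if $s\geq 4$ is even.
   Context: A partially filled array of size $m\times n$ is an $m\times n$ array in which some cells may be empty. An $\mathrm{MRS}(m,n;s,k;c)$ (magic rectangle set with empty cells) is a set of $c$ partially filled $m\times n$ arrays with integer entries such that: every integer in $\{1,2,\ldots,nkc\}$ appears exactly once, in exactly one of the arrays, and no other entries occur; in every array each row has exactly $s$ filled cells and each column has exactly $k$ filled cells; and there exist integers $x,y$ such that, in every array, the entries of each row sum to $x$ and the entries of each column sum to $y$. -}

module Defs where

open import Data.Nat using (ℕ; zero; suc; _+_; _*_; _≤_)
open import Data.Fin using (Fin; zero; suc)
open import Data.Maybe using (Maybe; just; nothing)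
open import Data.Product using (Σ; _×_; ∃; ∃-syntax; _,_)
open import Relation.Binary.PropositionalEquality using (_≡_)

-- A partially filled m × n array with natural-number entries:
-- a cell is either empty ('nothing') or holds an entry ('just v').
Array : ℕ → ℕ → Set
Array m n = Fin m → Fin n → Maybe ℕ

filledCount : ∀ {n} → (Fin n → Maybe ℕ) → ℕ
filledCount {zero} f = 0
filledCount {suc n} f with f zero
... | just _  = suc (filledCount (λ i → f (suc i)))
... | nothing = filledCount (λ i → f (suc i))

lineSum : ∀ {n} → (Fin n → Maybe ℕ) → ℕ
lineSum {zero} f = 0
lineSum {suc n} f with f zero
... | just v  = v + lineSum (λ i → f (suc i))
... | nothing = lineSum (λ i → f (suc i))

Cell : ℕ → ℕ → ℕ → Set
Cell c m n = Fin c × Fin m × Fin n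

record IsMRS (m n s k c : ℕ) (A : Fin c → Array m n) : Set where
  field
    entries-in-range : ∀ a i j v → A a i j ≡ just v → 1 ≤ v × v ≤ n * k * c
    each-appears     : ∀ v → 1 ≤ v → v ≤ n * k * c →
                       ∃[ a ] ∃[ i ] ∃[ j ] A a i j ≡ just v
    appears-once     : ∀ a i j a′ i′ j′ v → A a i j ≡ just v → A a′ i′ j′ ≡ just v →
                       (a , i , j) ≡ (a′ , i′ , j′)
    row-filled       : ∀ a i → filledCount (λ j → A a i j) ≡ s
    col-filled       : ∀ a j → filledCount (λ i → A a i j) ≡ k
    magic            : ∃[ x ] ∃[ y ]
                       ((∀ a i → lineSum (λ j → A a i j) ≡ x) ×
                        (∀ a j → lineSum (λ i → A a i j) ≡ y))

MRS : ℕ → ℕ → ℕ → ℕ → ℕ → Set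
MRS m n s k c = Σ (Fin c → Array m n) (IsMRS m n s k c)

{-
With H = cn and N = 2H, every column of the arrays constructed here holds the two entries
H + 1 + q and H - q for a label q < H used by exactly one column of the whole set. So every column
sums to N + 1, every value 1..N occurs exactly once, and a row with s entries sums to s(N + 1)/2
exactly when the labels whose large entry lies in it and those whose small entry lies in it have
equal total weight, a label q weighing 2q + 1. Such designs are glued from a few small ones checked
by evaluation: stacked, placed side by side, or collected into more arrays. Gluing shifts the labels
of one part, which keeps its rows in balance as long as each of them contains as many large as small
entries. Rows of length 4 come from 2 × 4 and 3 × 6 blocks; length 6 from 3 × 9, 4 × 12 and 5 × 15
blocks, or, for two rows, from a balanced pair of 2 × 6 arrays plus possibly one unbalanced one; longer
rows add blocks of length 4.

Conversely, adding up all entries row by row and column by column gives cmx = cny = N(N + 1)/2, so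
y = N + 1 and 2x = s(N + 1); as N + 1 is odd, s is even. If s = 2, the other entry in the row and the
other entry in the column of a given entry both equal N + 1 minus it, so that value occurs twice.
-}

module Submission where

open import Defs
open import Data.Empty using (⊥-elim)
open import Data.Fin as Fin using (Fin; zero; suc; toℕ; _↑ˡ_; _↑ʳ_; splitAt; join; combine)
open import Data.Fin.Properties as Fin using (all?; any?; *↔×; +↔⊎; join-splitAt; toℕ-↑ˡ; toℕ-↑ʳ; toℕ-injective)
open import Data.List using (List; []; _∷_; length) renaming (_++_ to _++ᴸ_)
open import Data.List.Membership.Propositional using (_∈_)
open import Data.List.Membership.Propositional.Properties using (∈-++⁺ˡ; ∈-++⁺ʳ; ∈-++⁻; ∈-∃++)
open import Data.List.Properties using (length-++)
open import Data.List.Relation.Unary.Any using (here; there)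
open import Data.Maybe using (Maybe; just; nothing)
open import Data.Nat using (ℕ; zero; suc; _+_; _*_; _∸_; _≤_; _<_; z≤n; s≤s; _<?_; _≟_; NonZero; >-nonZero)
open import Data.Nat.Divisibility using (_∣_; divides; ∣m+n∣m⇒∣n; ∣1⇒≡1)
open import Data.Nat.ListAction using () renaming (sum to sumᴸ)
open import Data.Nat.ListAction.Properties using () renaming (sum-++ to sumᴸ-++)
open import Data.Nat.Primality using (prime[2]; euclidsLemma)
open import Data.Nat.Properties
open import Data.Nat.Tactic.RingSolver using (solve-∀)
open import Data.Product using (Σ; _×_; _,_; proj₁; proj₂; ∃-syntax)
open import Data.Product.Function.NonDependent.Propositional using (_×-↔_)
open import Data.Sum using (_⊎_; inj₁; inj₂; [_,_]′)
open import Data.Sum.Properties using ([,]-∘)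
open import Data.Unit using (tt)
open import Data.Vec using (Vec; []; _∷_; lookup; tabulate)
open import Data.Vec.Functional using (Vector; _++_)
open import Data.Vec.Functional.Properties using (lookup-++ˡ; lookup-++ʳ)
open import Function using (_∘_; const)
open import Function.Bundles using (_⇔_; mk⇔; _↔_; Inverse)
open import Function.Properties.Inverse using (↔-refl; ↔-sym; ↔-trans)
open import Function.Related.TypeIsomorphisms using (×-distribˡ-⊎; ×-distribʳ-⊎)
open import Relation.Binary.PropositionalEquality
open import Relation.Nullary using (¬_; Dec; yes; no; ¬?)
open import Relation.Nullary.Decidable using (True; toWitness; _×-dec_; _→-dec_)

open import Algebra.Properties.CommutativeSemigroup +-commutativeSemigroup using (interchange)
open import Algebra.Properties.Semiring.Sum +-*-semiring
  using (sum; sum-syntax; sum-cong-≗; sum-replicate-zero; ∑-distrib-+; ∑-comm; *-distribʳ-sum)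

δ : ℕ → ℕ → ℕ
δ zero    zero    = 1
δ zero    (suc _) = 0
δ (suc _) zero    = 0
δ (suc a) (suc b) = δ a b

δ-refl : ∀ a → δ a a ≡ 1
δ-refl zero    = refl
δ-refl (suc a) = δ-refl a

δ-≢ : ∀ {a b} → a ≢ b → δ a b ≡ 0
δ-≢ {zero}  {zero}  a≢b = ⊥-elim (a≢b refl)
δ-≢ {zero}  {suc b} _   = refl
δ-≢ {suc a} {zero}  _   = refl
δ-≢ {suc a} {suc b} a≢b = δ-≢ (a≢b ∘ cong suc)

δ-+ : ∀ k a b → δ (k + a) (k + b) ≡ δ a b
δ-+ zero    a b = refl
δ-+ (suc k) a b = δ-+ k a b

sum-const : ∀ n v → ∑[ i < n ] v ≡ n * v
sum-const zero    v = refl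
sum-const (suc n) v = cong (v +_) (sum-const n v)

sum-zero : ∀ {n} (f : Vector ℕ n) → (∀ i → f i ≡ 0) → sum f ≡ 0
sum-zero {n} f f≡0 = trans (sum-cong-≗ f≡0) (sum-replicate-zero n)

sum-++ : ∀ {m n} (f : Vector ℕ m) (g : Vector ℕ n) → sum (f ++ g) ≡ sum f + sum g
sum-++ {zero}  f g = refl
sum-++ {suc m} f g = begin
  f zero + sum ((f ++ g) ∘ suc)   ≡⟨ cong (f zero +_) (sum-cong-≗ tail-++) ⟩
  f zero + sum ((f ∘ suc) ++ g)   ≡⟨ cong (f zero +_) (sum-++ (f ∘ suc) g) ⟩
  f zero + (sum (f ∘ suc) + sum g) ≡⟨ +-assoc (f zero) _ _ ⟨
  sum f + sum g                   ∎
  where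
  open ≡-Reasoning
  tail-++ : ∀ i → (f ++ g) (suc i) ≡ ((f ∘ suc) ++ g) i
  tail-++ i with splitAt m i
  ... | inj₁ _ = refl
  ... | inj₂ _ = refl

sum-δ : ∀ {m} r v → r < m → ∑[ i < m ] (δ r (toℕ i) * v) ≡ v
sum-δ {suc m} zero    v _         = trans (cong₂ _+_ (+-identityʳ v) (sum-replicate-zero m)) (+-identityʳ v)
sum-δ {suc m} (suc r) v (s≤s r<m) = sum-δ r v r<m

∀-split : ∀ {m n} {P : Fin (m + n) → Set} → (∀ i → P (i ↑ˡ n)) → (∀ i → P (m ↑ʳ i)) → ∀ i → P i
∀-split {m} {n} {P} left right i = subst P (join-splitAt m n i) (on (splitAt m i))
  where
  on : ∀ s → P (join m n s)
  on (inj₁ i) = left i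
  on (inj₂ i) = right i

all-++ : ∀ {A : Set} {m n} (P : A → Set) (xs : Vector A m) (ys : Vector A n) →
         (∀ i → P (xs i)) → (∀ i → P (ys i)) → ∀ i → P ((xs ++ ys) i)
all-++ P xs ys all-xs all-ys = ∀-split
  (λ i → subst P (sym (lookup-++ˡ xs ys i)) (all-xs i))
  (λ i → subst P (sym (lookup-++ʳ xs ys i)) (all-ys i))

value : Maybe ℕ → ℕ
value (just v) = v
value nothing  = 0

filled : Maybe ℕ → ℕ
filled (just _) = 1
filled nothing  = 0

lineSum≡sum : ∀ {n} (f : Fin n → Maybe ℕ) → lineSum f ≡ sum (value ∘ f)
lineSum≡sum {zero}  f = refl
lineSum≡sum {suc n} f with f zero
... | just v  = cong (v +_) (lineSum≡sum (f ∘ suc))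
... | nothing = lineSum≡sum (f ∘ suc)

filledCount≡sum : ∀ {n} (f : Fin n → Maybe ℕ) → filledCount f ≡ sum (filled ∘ f)
filledCount≡sum {zero}  f = refl
filledCount≡sum {suc n} f with f zero
... | just v  = cong suc (filledCount≡sum (f ∘ suc))
... | nothing = filledCount≡sum (f ∘ suc)

-- Designs

-- In the arrays built from a design with H = c * n, a column labelled q holds H + 1 + q in row
-- hiRow and H ∸ q in row loRow.
record Column : Set where
  constructor column
  field
    label hiRow loRow : ℕ

open Column

data Side : Set where
  hi lo : Side

row : Side → Column → ℕ
row hi = hiRow
row lo = loRow

-- Both entries of a column differ from its mean H + 1/2 by half the weight.
weight : Column → ℕ
weight x = suc (label x + label x)

Valid : ℕ → Column → Set
Valid m x = hiRow x < m × loRow x < m × hiRow x ≢ loRow x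

row-< : ∀ {m} x → Valid m x → ∀ σ → row σ x < m
row-< x (h< , _ , _) hi = h<
row-< x (_ , l< , _) lo = l<

shiftLabel : ℕ → Column → Column
shiftLabel d x = column (d + label x) (hiRow x) (loRow x)

shiftRows : ℕ → Column → Column
shiftRows k x = column (label x) (k + hiRow x) (k + loRow x)

valid-mono : ∀ {m m′} x → m ≤ m′ → Valid m x → Valid m′ x
valid-mono x m≤m′ (h< , l< , h≢l) = <-≤-trans h< m≤m′ , <-≤-trans l< m≤m′ , h≢l

valid-shiftRows : ∀ {m} k x → Valid m x → Valid (k + m) (shiftRows k x)
valid-shiftRows k x (h< , l< , h≢l) = +-monoʳ-< k h< , +-monoʳ-< k l< , h≢l ∘ +-cancelˡ-≡ k _ _

tally : ∀ {n} → Side → (Column → ℕ) → ℕ → Vector Column n → ℕ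
tally σ f i xs = sum (λ j → δ (row σ (xs j)) i * f (xs j))

count mass : ∀ {n} → Side → ℕ → Vector Column n → ℕ
count σ = tally σ (const 1)
mass  σ = tally σ weight

RowCount : ∀ {n} → ℕ → ℕ → Vector Column n → Set
RowCount s i xs = count hi i xs + count lo i xs ≡ s

RowMass RowBalanced : ∀ {n} → ℕ → Vector Column n → Set
RowMass     i xs = mass hi i xs ≡ mass lo i xs
RowBalanced i xs = count hi i xs ≡ count lo i xs

row-shiftRows : ∀ k σ x → row σ (shiftRows k x) ≡ k + row σ x
row-shiftRows k hi x = refl
row-shiftRows k lo x = refl

row-shiftLabel : ∀ d σ x → row σ (shiftLabel d x) ≡ row σ x
row-shiftLabel d hi x = refl
row-shiftLabel d lo x = refl

tally-++ : ∀ {m n} σ f i (xs : Vector Column m) (ys : Vector Column n) →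
           tally σ f i (xs ++ ys) ≡ tally σ f i xs + tally σ f i ys
tally-++ {m} σ f i xs ys = trans (sum-cong-≗ (λ j → [,]-∘ term (splitAt m j))) (sum-++ (term ∘ xs) (term ∘ ys))
  where
  term : Column → ℕ
  term x = δ (row σ x) i * f x

tally-≡0 : ∀ {n} σ f i (xs : Vector Column n) → (∀ j → row σ (xs j) ≢ i) → tally σ f i xs ≡ 0
tally-≡0 σ f i xs ≢i = sum-zero _ (λ j → cong (_* f (xs j)) (δ-≢ (≢i j)))

tally-shiftRows : ∀ {n} k σ f i (xs : Vector Column n) →
                  tally σ f (k + i) (shiftRows k ∘ xs) ≡ tally σ (f ∘ shiftRows k) i xs
tally-shiftRows k σ f i xs = sum-cong-≗ λ j →
  cong (_* f (shiftRows k (xs j))) (trans (cong (λ r → δ r (k + i)) (row-shiftRows k σ (xs j))) (δ-+ k _ i))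

tally-shiftLabel : ∀ {n} d σ f i (xs : Vector Column n) →
                   tally σ f i (shiftLabel d ∘ xs) ≡ tally σ (f ∘ shiftLabel d) i xs
tally-shiftLabel d σ f i xs = sum-cong-≗ λ j →
  cong (λ r → δ r i * f (shiftLabel d (xs j))) (row-shiftLabel d σ (xs j))

mass-shiftLabel : ∀ {n} d σ i (xs : Vector Column n) →
                  mass σ i (shiftLabel d ∘ xs) ≡ mass σ i xs + count σ i xs * (d + d)
mass-shiftLabel d σ i xs = begin
  mass σ i (shiftLabel d ∘ xs)                       ≡⟨ tally-shiftLabel d σ weight i xs ⟩
  tally σ (weight ∘ shiftLabel d) i xs               ≡⟨ sum-cong-≗ (λ j → shifted (δ (row σ (xs j)) i) (label (xs j)) d) ⟩
  sum (λ j → δ (row σ (xs j)) i * weight (xs j) + δ (row σ (xs j)) i * 1 * (d + d))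
                                                     ≡⟨ ∑-distrib-+ (λ j → δ (row σ (xs j)) i * weight (xs j)) (λ j → δ (row σ (xs j)) i * 1 * (d + d)) ⟩
  mass σ i xs + sum (λ j → δ (row σ (xs j)) i * 1 * (d + d))
                                                     ≡⟨ cong (mass σ i xs +_) (*-distribʳ-sum (d + d) (λ j → δ (row σ (xs j)) i * 1)) ⟨
  mass σ i xs + count σ i xs * (d + d)               ∎
  where
  open ≡-Reasoning
  shifted : ∀ e q d → e * suc (d + q + (d + q)) ≡ e * suc (q + q) + e * 1 * (d + d)
  shifted = solve-∀

mass-shiftLabel-balanced : ∀ {n} d i (xs : Vector Column n) →
  RowBalanced i xs → RowMass i xs → RowMass i (shiftLabel d ∘ xs)
mass-shiftLabel-balanced d i xs count≡ mass≡ = begin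
  mass hi i (shiftLabel d ∘ xs)          ≡⟨ mass-shiftLabel d hi i xs ⟩
  mass hi i xs + count hi i xs * (d + d) ≡⟨ cong₂ (λ u v → u + v * (d + d)) mass≡ count≡ ⟩
  mass lo i xs + count lo i xs * (d + d) ≡⟨ mass-shiftLabel d lo i xs ⟨
  mass lo i (shiftLabel d ∘ xs)          ∎
  where open ≡-Reasoning

record IsNumbering {I : Set} (k : ℕ) (ℓ : I → ℕ) : Set where
  field
    bounded    : ∀ x → ℓ x < k
    injective  : ∀ {x y} → ℓ x ≡ ℓ y → x ≡ y
    surjective : ∀ g → g < k → ∃[ x ] ℓ x ≡ g

module _ {I : Set} where

  numbering-∅ : {ℓ : I → ℕ} → ¬ I → IsNumbering 0 ℓ
  numbering-∅ ¬I = record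
    { bounded    = ⊥-elim ∘ ¬I
    ; injective  = λ {x} _ → ⊥-elim (¬I x)
    ; surjective = λ _ ()
    }

  numbering-cong : ∀ {k k′} {ℓ ℓ′ : I → ℕ} → k ≡ k′ → ℓ ≗ ℓ′ →
                   IsNumbering k ℓ → IsNumbering k′ ℓ′
  numbering-cong refl ℓ≗ℓ′ N = record
    { bounded    = λ x → subst (_< _) (ℓ≗ℓ′ x) (bounded x)
    ; injective  = λ {x} {y} eq → injective (trans (ℓ≗ℓ′ x) (trans eq (sym (ℓ≗ℓ′ y))))
    ; surjective = λ g g< → let x , ℓx≡g = surjective g g< in x , trans (sym (ℓ≗ℓ′ x)) ℓx≡g
    }
    where open IsNumbering N

  numbering-↔ : ∀ {J : Set} {k} {ℓ : I → ℕ} (φ : J ↔ I) →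
                IsNumbering k ℓ → IsNumbering k (ℓ ∘ Inverse.to φ)
  numbering-↔ {ℓ = ℓ} φ N = record
    { bounded    = bounded ∘ to
    ; injective  = λ {x} {y} eq →
                   trans (sym (strictlyInverseʳ x)) (trans (cong from (injective eq)) (strictlyInverseʳ y))
    ; surjective = λ g g< → let x , ℓx≡g = surjective g g< in
                   from x , trans (cong ℓ (strictlyInverseˡ x)) ℓx≡g
    }
    where
    open IsNumbering N
    open Inverse φ

numbering-⊎ : ∀ {I J : Set} {d e} {ℓ₁ : I → ℕ} {ℓ₂ : J → ℕ} →
              IsNumbering d ℓ₁ → IsNumbering e ℓ₂ → IsNumbering (e + d) [ (e +_) ∘ ℓ₁ , ℓ₂ ]′
numbering-⊎ {d = d} {e} {ℓ₁} {ℓ₂} N₁ N₂ = record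
  { bounded    = λ { (inj₁ x) → +-monoʳ-< e (N₁.bounded x)
                   ; (inj₂ y) → <-≤-trans (N₂.bounded y) (m≤m+n e d) }
  ; injective  = injective
  ; surjective = surjective
  }
  where
  module N₁ = IsNumbering N₁
  module N₂ = IsNumbering N₂
  ℓ = [ (e +_) ∘ ℓ₁ , ℓ₂ ]′

  injective : ∀ {x y} → ℓ x ≡ ℓ y → x ≡ y
  injective {inj₁ x} {inj₁ y} eq = cong inj₁ (N₁.injective (+-cancelˡ-≡ e _ _ eq))
  injective {inj₂ x} {inj₂ y} eq = cong inj₂ (N₂.injective eq)
  injective {inj₁ x} {inj₂ y} eq = ⊥-elim (m+n≮m e _ (subst (_< e) (sym eq) (N₂.bounded y)))
  injective {inj₂ x} {inj₁ y} eq = ⊥-elim (m+n≮m e _ (subst (_< e) eq (N₂.bounded x)))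

  surjective : ∀ g → g < e + d → ∃[ x ] ℓ x ≡ g
  surjective g g< with g <? e
  ... | yes g<e = let y , ℓy≡g = N₂.surjective g g<e in inj₂ y , ℓy≡g
  ... | no  g≮e =
    let e≤g = ≮⇒≥ g≮e
        x , ℓx≡g∸e = N₁.surjective (g ∸ e) (+-cancelˡ-< e _ _ (subst (_< e + d) (sym (m+[n∸m]≡n e≤g)) g<))
    in inj₁ x , trans (cong (e +_) ℓx≡g∸e) (m+[n∸m]≡n e≤g)

labelOf : ∀ {c n} → (Fin c → Vector Column n) → Fin c × Fin n → ℕ
labelOf cols (a , j) = label (cols a j)

record Design (m n s c : ℕ) : Set where
  field
    columns   : Fin c → Vector Column n
    valid     : ∀ a j → Valid m (columns a j)
    numbering : IsNumbering (c * n) (labelOf columns)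
    row-count : ∀ a (i : Fin m) → RowCount s (toℕ i) (columns a)
    row-mass  : ∀ a (i : Fin m) → RowMass (toℕ i) (columns a)

Balanced : ∀ {m n s c} → Design m n s c → Set
Balanced {m} D = ∀ a (i : Fin m) → RowBalanced (toℕ i) (Design.columns D a)

BalancedDesign : ℕ → ℕ → ℕ → ℕ → Set
BalancedDesign m n s c = Σ (Design m n s c) Balanced

-- From a design to a magic rectangle set

entryValue : ℕ → Side → Column → ℕ
entryValue H hi x = suc (H + label x)
entryValue H lo x = H ∸ label x

entry : ℕ → ℕ → Column → Maybe ℕ
entry H i x with hiRow x ≟ i
... | yes _ = just (entryValue H hi x)
... | no  _ with loRow x ≟ i
...   | yes _ = just (entryValue H lo x)
...   | no  _ = nothing

entry-row : ∀ H σ x → hiRow x ≢ loRow x → entry H (row σ x) x ≡ just (entryValue H σ x)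
entry-row H hi x _ with hiRow x ≟ hiRow x
... | yes _   = refl
... | no  h≢h = ⊥-elim (h≢h refl)
entry-row H lo x h≢l with hiRow x ≟ loRow x
... | yes h≡l = ⊥-elim (h≢l h≡l)
... | no  _ with loRow x ≟ loRow x
...   | yes _   = refl
...   | no  l≢l = ⊥-elim (l≢l refl)

entry-inv : ∀ H i x {v} → entry H i x ≡ just v → ∃[ σ ] row σ x ≡ i × entryValue H σ x ≡ v
entry-inv H i x eq with hiRow x ≟ i
entry-inv H i x refl | yes h≡i = hi , h≡i , refl
... | no _ with loRow x ≟ i
entry-inv H i x refl | no _ | yes l≡i = lo , l≡i , refl
entry-inv H i x ()   | no _ | no _

entryValue-injective : ∀ {H σ σ′ x x′} → label x < H → label x′ < H →
                       entryValue H σ x ≡ entryValue H σ′ x′ → σ ≡ σ′ × label x ≡ label x′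
entryValue-injective {H} {hi} {hi} _ _ eq = refl , +-cancelˡ-≡ H _ _ (suc-injective eq)
entryValue-injective {H} {lo} {lo} q< q′< eq =
  refl , trans (sym (m∸[m∸n]≡n (<⇒≤ q<))) (trans (cong (H ∸_) eq) (m∸[m∸n]≡n (<⇒≤ q′<)))
entryValue-injective {H} {hi} {lo} {x′ = x′} _ _ eq = ⊥-elim (<⇒≱ (s≤s (m≤m+n H _)) (subst (_≤ H) (sym eq) (m∸n≤m H (label x′))))
entryValue-injective {H} {lo} {hi} {x} _ _ eq = ⊥-elim (<⇒≱ (s≤s (m≤m+n H _)) (subst (_≤ H) eq (m∸n≤m H (label x))))

entry-δ : ∀ (f : Maybe ℕ → ℕ) → f nothing ≡ 0 → ∀ H i x → hiRow x ≢ loRow x →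
          f (entry H i x) ≡ δ (hiRow x) i * f (just (entryValue H hi x)) + δ (loRow x) i * f (just (entryValue H lo x))
entry-δ f f0 H i x h≢l with hiRow x ≟ i
... | yes refl rewrite δ-refl (hiRow x) | δ-≢ (h≢l ∘ sym) = sym (trans (+-identityʳ _) (+-identityʳ _))
... | no h≢i with loRow x ≟ i
...   | yes refl rewrite δ-≢ h≢i | δ-refl (loRow x) = sym (+-identityʳ _)
...   | no l≢i rewrite δ-≢ h≢i | δ-≢ l≢i = f0

double-entry : ∀ a b H q → q ≤ H →
  (a * suc (H + q) + b * (H ∸ q)) + (a * suc (H + q) + b * (H ∸ q)) + b * suc (q + q)
  ≡ (a * 1 + b * 1) * suc (H + H) + a * suc (q + q)
double-entry a b H q q≤H =
  subst (λ h → (a * suc (h + q) + b * d) + (a * suc (h + q) + b * d) + b * suc (q + q)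
               ≡ (a * 1 + b * 1) * suc (h + h) + a * suc (q + q))
        (m+[n∸m]≡n q≤H) (identity a b q d)
  where
  d = H ∸ q
  identity : ∀ a b q d → (a * suc (q + d + q) + b * d) + (a * suc (q + d + q) + b * d) + b * suc (q + q)
                         ≡ (a * 1 + b * 1) * suc (q + d + (q + d)) + a * suc (q + q)
  identity = solve-∀

sum-column : ∀ {m} x a b → Valid m x →
             ∑[ i < m ] (δ (hiRow x) (toℕ i) * a + δ (loRow x) (toℕ i) * b) ≡ a + b
sum-column {m} x a b (h< , l< , _) =
  trans (∑-distrib-+ {m} (λ i → δ (hiRow x) (toℕ i) * a) (λ i → δ (loRow x) (toℕ i) * b))
        (cong₂ _+_ (sum-δ {m} (hiRow x) a h<) (sum-δ {m} (loRow x) b l<))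

row-sum-identity : ∀ {n} H i (xs : Vector Column n) → (∀ j → hiRow (xs j) ≢ loRow (xs j)) → (∀ j → label (xs j) ≤ H) →
          let S = lineSum (λ j → entry H i (xs j)) in
          S + S + mass lo i xs ≡ (count hi i xs + count lo i xs) * suc (H + H) + mass hi i xs
row-sum-identity H i xs h≢l q≤H = begin
  S + S + mass lo i xs
    ≡⟨ cong (λ t → t + t + mass lo i xs) (lineSum≡sum (λ j → entry H i (xs j))) ⟩
  sum v + sum v + mass lo i xs
    ≡⟨ cong (_+ mass lo i xs) (∑-distrib-+ v v) ⟨
  sum (λ j → v j + v j) + mass lo i xs
    ≡⟨ ∑-distrib-+ (λ j → v j + v j) (λ j → δₗ j * weight (xs j)) ⟨
  sum (λ j → v j + v j + δₗ j * weight (xs j))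
    ≡⟨ sum-cong-≗ per-column ⟩
  sum (λ j → (δₕ j * 1 + δₗ j * 1) * suc (H + H) + δₕ j * weight (xs j))
    ≡⟨ ∑-distrib-+ (λ j → (δₕ j * 1 + δₗ j * 1) * suc (H + H)) (λ j → δₕ j * weight (xs j)) ⟩
  sum (λ j → (δₕ j * 1 + δₗ j * 1) * suc (H + H)) + mass hi i xs
    ≡⟨ cong (_+ mass hi i xs) (*-distribʳ-sum (suc (H + H)) (λ j → δₕ j * 1 + δₗ j * 1)) ⟨
  sum (λ j → δₕ j * 1 + δₗ j * 1) * suc (H + H) + mass hi i xs
    ≡⟨ cong (λ t → t * suc (H + H) + mass hi i xs) (∑-distrib-+ (λ j → δₕ j * 1) (λ j → δₗ j * 1)) ⟩
  (count hi i xs + count lo i xs) * suc (H + H) + mass hi i xs ∎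
  where
  open ≡-Reasoning
  S = lineSum (λ j → entry H i (xs j))
  v = λ j → value (entry H i (xs j))
  δₕ = λ j → δ (hiRow (xs j)) i
  δₗ = λ j → δ (loRow (xs j)) i
  per-column : ∀ j → v j + v j + δₗ j * weight (xs j) ≡ (δₕ j * 1 + δₗ j * 1) * suc (H + H) + δₕ j * weight (xs j)
  per-column j = trans (cong (λ t → t + t + δₗ j * weight (xs j)) (entry-δ value refl H i (xs j) (h≢l j)))
                       (double-entry (δₕ j) (δₗ j) H (label (xs j)) (q≤H j))

m+m≡n+n⇒m≡n : ∀ m n → m + m ≡ n + n → m ≡ n
m+m≡n+n⇒m≡n m n eq = *-cancelˡ-≡ m n 2 (trans (cong (m +_) (+-identityʳ m)) (trans eq (cong (n +_) (sym (+-identityʳ n)))))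

module _ {m n s c} (D : Design m n s c) where
  open Design D
  open IsNumbering numbering
  private
    H = c * n

    N≡H+H : n * 2 * c ≡ H + H
    N≡H+H = reorder n c
      where
      reorder : ∀ n c → n * 2 * c ≡ c * n + c * n
      reorder = solve-∀

    label< : ∀ a j → label (columns a j) < H
    label< a j = bounded (a , j)

    h≢l : ∀ a j → hiRow (columns a j) ≢ loRow (columns a j)
    h≢l a j = proj₂ (proj₂ (valid a j))

  toArray : Fin c → Array m n
  toArray a i j = entry H (toℕ i) (columns a j)

  private
    occurs : ∀ a j σ → ∃[ i ] toArray a i j ≡ just (entryValue H σ (columns a j))
    occurs a j σ = Fin.fromℕ< r<m , trans (cong (λ r → entry H r x) (Fin.toℕ-fromℕ< r<m)) (entry-row H σ x (h≢l a j))
      where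
      x = columns a j
      r<m = row-< x (valid a j) σ

    in-range : ∀ a i j v → toArray a i j ≡ just v → 1 ≤ v × v ≤ n * 2 * c
    in-range a i j v eq with entry-inv H (toℕ i) (columns a j) eq
    ... | hi , _ , refl = s≤s z≤n , subst (entryValue H hi x ≤_) (sym N≡H+H) (subst (_≤ H + H) (+-suc H _) (+-monoʳ-≤ H (label< a j)))
      where x = columns a j
    ... | lo , _ , refl = m<n⇒0<n∸m (label< a j) , subst (entryValue H lo x ≤_) (sym N≡H+H) (≤-trans (m∸n≤m H (label x)) (m≤m+n H H))
      where x = columns a j

    appears : ∀ v → 1 ≤ v → v ≤ n * 2 * c → ∃[ a ] ∃[ i ] ∃[ j ] toArray a i j ≡ just v
    appears v 1≤v v≤N with v ≤? H
    ... | yes v≤H =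
      let (a , j) , q≡ = surjective (H ∸ v) (∸-monoʳ-< 1≤v v≤H)
          i , eq = occurs a j lo
      in a , i , j , trans eq (cong just (trans (cong (H ∸_) q≡) (m∸[m∸n]≡n v≤H)))
    ... | no v≰H =
      let H<v = ≰⇒> v≰H
          (a , j) , q≡ = surjective (v ∸ suc H)
                             (subst (v ∸ suc H <_) (m+n∸m≡n H H) (∸-monoˡ-< (s≤s (subst (v ≤_) N≡H+H v≤N)) H<v))
          i , eq = occurs a j hi
      in a , i , j , trans eq (cong just (trans (cong (λ q → suc (H + q)) q≡) (m+[n∸m]≡n H<v)))

    once : ∀ a i j a′ i′ j′ v → toArray a i j ≡ just v → toArray a′ i′ j′ ≡ just v → (a , i , j) ≡ (a′ , i′ , j′)
    once a i j a′ i′ j′ v eq eq′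
      with σ , r≡ , val≡ ← entry-inv H (toℕ i) (columns a j) eq
         | σ′ , r≡′ , val≡′ ← entry-inv H (toℕ i′) (columns a′ j′) eq′
      with refl , q≡ ← entryValue-injective {σ = σ} {σ′} (label< a j) (label< a′ j′) (trans val≡ (sym val≡′))
      with refl ← injective {a , j} {a′ , j′} q≡
      = cong (λ i → a , i , j) (toℕ-injective (trans (sym r≡) r≡′))

    row-filled : ∀ a i → filledCount (λ j → toArray a i j) ≡ s
    row-filled a i = begin
      filledCount (λ j → toArray a i j)                           ≡⟨ filledCount≡sum (λ j → toArray a i j) ⟩
      sum (λ j → filled (toArray a i j))                          ≡⟨ sum-cong-≗ (λ j → entry-δ filled refl H r (columns a j) (h≢l a j)) ⟩
      sum (λ j → δ (hiRow (columns a j)) r * 1 + δ (loRow (columns a j)) r * 1)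
                                                                  ≡⟨ ∑-distrib-+ (λ j → δ (hiRow (columns a j)) r * 1) _ ⟩
      count hi r (columns a) + count lo r (columns a)             ≡⟨ row-count a i ⟩
      s                                                           ∎
      where
      open ≡-Reasoning
      r = toℕ i

    column-filled : ∀ a j → filledCount (λ i → toArray a i j) ≡ 2
    column-filled a j =
      trans (filledCount≡sum (λ i → toArray a i j))
        (trans (sum-cong-≗ {m} (λ i → entry-δ filled refl H (toℕ i) (columns a j) (h≢l a j)))
               (sum-column {m} (columns a j) 1 1 (valid a j)))

    column-sum : ∀ a j → lineSum (λ i → toArray a i j) ≡ suc (n * 2 * c)
    column-sum a j = begin
      lineSum (λ i → toArray a i j)              ≡⟨ lineSum≡sum (λ i → toArray a i j) ⟩
      ∑[ i < m ] value (toArray a i j)           ≡⟨ sum-cong-≗ {m} (λ i → entry-δ value refl H (toℕ i) x (h≢l a j)) ⟩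
      ∑[ i < m ] (δ (hiRow x) (toℕ i) * entryValue H hi x + δ (loRow x) (toℕ i) * entryValue H lo x)
                                                 ≡⟨ sum-column x (entryValue H hi x) (entryValue H lo x) (valid a j) ⟩
      suc (H + q) + (H ∸ q)                      ≡⟨ cong suc (trans (+-assoc H q (H ∸ q)) (cong (H +_) (m+[n∸m]≡n (<⇒≤ (label< a j))))) ⟩
      suc (H + H)                                ≡⟨ cong suc N≡H+H ⟨
      suc (n * 2 * c)                            ∎
      where
      open ≡-Reasoning
      x = columns a j
      q = label x

    twice-row-sum : ∀ a i → let S = lineSum (λ j → toArray a i j) in S + S ≡ s * suc (n * 2 * c)
    twice-row-sum a i = +-cancelʳ-≡ (mass lo r xs) _ _ (begin
      S + S + mass lo r xs                                  ≡⟨ row-sum-identity H r xs (h≢l a) (λ j → <⇒≤ (label< a j)) ⟩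
      (count hi r xs + count lo r xs) * suc (H + H) + mass hi r xs
                                                            ≡⟨ cong₂ (λ t u → t * suc u + mass hi r xs) (row-count a i) (sym N≡H+H) ⟩
      s * suc (n * 2 * c) + mass hi r xs                    ≡⟨ cong (s * suc (n * 2 * c) +_) (row-mass a i) ⟩
      s * suc (n * 2 * c) + mass lo r xs                    ∎)
      where
      open ≡-Reasoning
      r = toℕ i
      xs = columns a
      S = lineSum (λ j → toArray a i j)

  toMRS : ∀ k → s ≡ k * 2 → MRS m n s 2 c
  toMRS k refl = toArray , record
    { entries-in-range = in-range
    ; each-appears     = appears
    ; appears-once     = once
    ; row-filled       = row-filled
    ; col-filled       = column-filled
    ; magic            = k * suc (n * 2 * c) , suc (n * 2 * c) ,
                         (λ a i → m+m≡n+n⇒m≡n _ _ (trans (twice-row-sum a i) (halves k (suc (n * 2 * c))))) ,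
                         column-sum
    }
    where
    halves : ∀ k y → k * 2 * y ≡ k * y + k * y
    halves = solve-∀

sum-count : ∀ {m n} σ (xs : Vector Column n) → (∀ j → row σ (xs j) < m) → ∑[ i < m ] count σ (toℕ i) xs ≡ n
sum-count {m} {n} σ xs row< = begin
  ∑[ i < m ] ∑[ j < n ] (δ (row σ (xs j)) (toℕ i) * 1) ≡⟨ ∑-comm {m} {n} (λ i j → δ (row σ (xs j)) (toℕ i) * 1) ⟩
  ∑[ j < n ] ∑[ i < m ] (δ (row σ (xs j)) (toℕ i) * 1) ≡⟨ sum-cong-≗ {n} (λ j → sum-δ {m} (row σ (xs j)) 1 (row< j)) ⟩
  ∑[ j < n ] 1                                          ≡⟨ trans (sum-const n 1) (*-identityʳ n) ⟩
  n                                                     ∎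
  where open ≡-Reasoning

width : ∀ {m n s c} → Design m n s c → Fin c → m * s ≡ 2 * n
width {m} {n} {s} D a = begin
  m * s                                                       ≡⟨ sum-const m s ⟨
  ∑[ i < m ] s                                                ≡⟨ sum-cong-≗ {m} (λ i → row-count a i) ⟨
  ∑[ i < m ] (count hi (toℕ i) (columns a) + count lo (toℕ i) (columns a))
                                                              ≡⟨ ∑-distrib-+ {m} (λ i → count hi (toℕ i) (columns a)) (λ i → count lo (toℕ i) (columns a)) ⟩
  ∑[ i < m ] count hi (toℕ i) (columns a) + ∑[ i < m ] count lo (toℕ i) (columns a)
                                                              ≡⟨ cong₂ _+_ (sum-count {m} hi (columns a) (λ j → row-< (columns a j) (valid a j) hi))
                                                                           (sum-count {m} lo (columns a) (λ j → row-< (columns a j) (valid a j) lo)) ⟩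
  n + n                                                       ≡⟨ cong (n +_) (+-identityʳ n) ⟨
  2 * n                                                       ∎
  where
  open ≡-Reasoning
  open Design D

-- Gluing designs

noArrays : ∀ {m n s} → BalancedDesign m n s 0
noArrays = record
  { columns   = λ ()
  ; valid     = λ ()
  ; numbering = numbering-∅ λ ()
  ; row-count = λ ()
  ; row-mass  = λ ()
  } , λ ()

numbering-union : ∀ {c₁ c₂ n} (xs : Fin c₁ → Vector Column n) (ys : Fin c₂ → Vector Column n) →
                  IsNumbering (c₁ * n) (labelOf xs) → IsNumbering (c₂ * n) (labelOf ys) →
                  IsNumbering ((c₁ + c₂) * n) (labelOf ((λ a → shiftLabel (c₂ * n) ∘ xs a) ++ ys))
numbering-union {c₁} {c₂} {n} xs ys N₁ N₂ =
  numbering-cong (trans (+-comm (c₂ * n) (c₁ * n)) (sym (*-distribʳ-+ n c₁ c₂))) labels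
    (numbering-↔ split (numbering-⊎ N₁ N₂))
  where
  split : (Fin (c₁ + c₂) × Fin n) ↔ (Fin c₁ × Fin n ⊎ Fin c₂ × Fin n)
  split = ↔-trans (+↔⊎ ×-↔ ↔-refl) ×-distribʳ-⊎

  labels : [ (c₂ * n +_) ∘ labelOf xs , labelOf ys ]′ ∘ Inverse.to split
           ≗ labelOf ((λ a → shiftLabel (c₂ * n) ∘ xs a) ++ ys)
  labels (a , j) with splitAt c₁ a
  ... | inj₁ _ = refl
  ... | inj₂ _ = refl

numbering-beside : ∀ {c n₁ n₂} (xs : Fin c → Vector Column n₁) (ys : Fin c → Vector Column n₂) →
                   IsNumbering (c * n₁) (labelOf xs) → IsNumbering (c * n₂) (labelOf ys) →
                   IsNumbering (c * (n₁ + n₂)) (labelOf (λ a → (shiftLabel (c * n₂) ∘ xs a) ++ ys a))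
numbering-beside {c} {n₁} {n₂} xs ys N₁ N₂ =
  numbering-cong (trans (+-comm (c * n₂) (c * n₁)) (sym (*-distribˡ-+ c n₁ n₂))) labels
    (numbering-↔ split (numbering-⊎ N₁ N₂))
  where
  split : (Fin c × Fin (n₁ + n₂)) ↔ (Fin c × Fin n₁ ⊎ Fin c × Fin n₂)
  split = ↔-trans (↔-refl ×-↔ +↔⊎) ×-distribˡ-⊎

  labels : [ (c * n₂ +_) ∘ labelOf xs , labelOf ys ]′ ∘ Inverse.to split
           ≗ labelOf (λ a → (shiftLabel (c * n₂) ∘ xs a) ++ ys a)
  labels (a , j) with splitAt n₁ j
  ... | inj₁ _ = refl
  ... | inj₂ _ = refl

module _ {m n s c₁ c₂} (B₁ : BalancedDesign m n s c₁) (D₂ : Design m n s c₂) where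
  private
    D₁ = proj₁ B₁
    bal₁ = proj₂ B₁
    module D₁ = Design D₁
    module D₂ = Design D₂
    d = c₂ * n
    shifted = λ a → shiftLabel d ∘ D₁.columns a
    cols = shifted ++ D₂.columns

  union : Design m n s (c₁ + c₂)
  union = record
    { columns   = cols
    ; valid     = all-++ (λ xs → ∀ j → Valid m (xs j)) shifted D₂.columns D₁.valid D₂.valid
    ; numbering = numbering-union D₁.columns D₂.columns D₁.numbering D₂.numbering
    ; row-count = all-++ (λ xs → ∀ (i : Fin m) → RowCount s (toℕ i) xs) shifted D₂.columns
                    D₁.row-count D₂.row-count
    ; row-mass  = all-++ (λ xs → ∀ (i : Fin m) → RowMass (toℕ i) xs) shifted D₂.columns
                    (λ a i → mass-shiftLabel-balanced d (toℕ i) (D₁.columns a) (bal₁ a i) (D₁.row-mass a i))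
                    D₂.row-mass
    }

  union-balanced : Balanced D₂ → Balanced union
  union-balanced = all-++ (λ xs → ∀ (i : Fin m) → RowBalanced (toℕ i) xs) shifted D₂.columns bal₁

module _ {m n₁ n₂ s₁ s₂ c} (B₁ : BalancedDesign m n₁ s₁ c) (D₂ : Design m n₂ s₂ c) where
  private
    D₁ = proj₁ B₁
    bal₁ = proj₂ B₁
    module D₁ = Design D₁
    module D₂ = Design D₂
    d = c * n₂
    shifted = λ a → shiftLabel d ∘ D₁.columns a
    cols = λ a → shifted a ++ D₂.columns a

    row-count : ∀ a (i : Fin m) → RowCount (s₁ + s₂) (toℕ i) (cols a)
    row-count a i = begin
      count hi r (cols a) + count lo r (cols a)
        ≡⟨ cong₂ _+_ (tally-++ hi (const 1) r (shifted a) (D₂.columns a))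
                     (tally-++ lo (const 1) r (shifted a) (D₂.columns a)) ⟩
      (count hi r (shifted a) + count hi r (D₂.columns a)) + (count lo r (shifted a) + count lo r (D₂.columns a))
        ≡⟨ interchange (count hi r (shifted a)) _ _ _ ⟩
      (count hi r (shifted a) + count lo r (shifted a)) + (count hi r (D₂.columns a) + count lo r (D₂.columns a))
        ≡⟨ cong₂ _+_ (D₁.row-count a i) (D₂.row-count a i) ⟩
      s₁ + s₂ ∎
      where
      open ≡-Reasoning
      r = toℕ i

    row-mass : ∀ a (i : Fin m) → RowMass (toℕ i) (cols a)
    row-mass a i = begin
      mass hi r (cols a)                                  ≡⟨ tally-++ hi weight r (shifted a) (D₂.columns a) ⟩
      mass hi r (shifted a) + mass hi r (D₂.columns a)    ≡⟨ cong₂ _+_ shifted-mass (D₂.row-mass a i) ⟩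
      mass lo r (shifted a) + mass lo r (D₂.columns a)    ≡⟨ tally-++ lo weight r (shifted a) (D₂.columns a) ⟨
      mass lo r (cols a)                                  ∎
      where
      open ≡-Reasoning
      r = toℕ i
      shifted-mass = mass-shiftLabel-balanced d r (D₁.columns a) (bal₁ a i) (D₁.row-mass a i)

  beside : Design m (n₁ + n₂) (s₁ + s₂) c
  beside = record
    { columns   = cols
    ; valid     = λ a → all-++ (Valid m) (shifted a) (D₂.columns a) (D₁.valid a) (D₂.valid a)
    ; numbering = numbering-beside D₁.columns D₂.columns D₁.numbering D₂.numbering
    ; row-count = row-count
    ; row-mass  = row-mass
    }

module _ {m₁ m₂ n₁ n₂ s c} (B₁ : BalancedDesign m₁ n₁ s c) (D₂ : Design m₂ n₂ s c) where
  private
    D₁ = proj₁ B₁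
    bal₁ = proj₂ B₁
    module D₁ = Design D₁
    module D₂ = Design D₂
    d = c * n₂
    top    = λ a → shiftLabel d ∘ D₁.columns a
    bottom = λ a → shiftRows m₁ ∘ D₂.columns a
    cols   = λ a → top a ++ bottom a

    tally-top : ∀ a σ f (i : Fin m₁) → tally σ f (toℕ (i ↑ˡ m₂)) (cols a) ≡ tally σ f (toℕ i) (top a)
    tally-top a σ f i = begin
      tally σ f (toℕ (i ↑ˡ m₂)) (cols a)              ≡⟨ cong (λ r → tally σ f r (cols a)) (toℕ-↑ˡ i m₂) ⟩
      tally σ f (toℕ i) (cols a)                      ≡⟨ tally-++ σ f (toℕ i) (top a) (bottom a) ⟩
      tally σ f (toℕ i) (top a) + tally σ f (toℕ i) (bottom a)
                                                      ≡⟨ cong (tally σ f (toℕ i) (top a) +_) (tally-≡0 σ f (toℕ i) (bottom a) below) ⟩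
      tally σ f (toℕ i) (top a) + 0                   ≡⟨ +-identityʳ (tally σ f (toℕ i) (top a)) ⟩
      tally σ f (toℕ i) (top a)                       ∎
      where
      open ≡-Reasoning
      below : ∀ j → row σ (bottom a j) ≢ toℕ i
      below j eq = <⇒≱ (Fin.toℕ<n i)
        (subst (m₁ ≤_) (trans (sym (row-shiftRows m₁ σ (D₂.columns a j))) eq) (m≤m+n m₁ _))

    tally-bottom : ∀ a σ f (i : Fin m₂) →
                   tally σ f (toℕ (m₁ ↑ʳ i)) (cols a) ≡ tally σ (f ∘ shiftRows m₁) (toℕ i) (D₂.columns a)
    tally-bottom a σ f i = begin
      tally σ f (toℕ (m₁ ↑ʳ i)) (cols a)              ≡⟨ cong (λ r → tally σ f r (cols a)) (toℕ-↑ʳ m₁ i) ⟩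
      tally σ f r (cols a)                            ≡⟨ tally-++ σ f r (top a) (bottom a) ⟩
      tally σ f r (top a) + tally σ f r (bottom a)    ≡⟨ cong (_+ tally σ f r (bottom a)) (tally-≡0 σ f r (top a) above) ⟩
      tally σ f r (bottom a)                          ≡⟨ tally-shiftRows m₁ σ f (toℕ i) (D₂.columns a) ⟩
      tally σ (f ∘ shiftRows m₁) (toℕ i) (D₂.columns a) ∎
      where
      open ≡-Reasoning
      r = m₁ + toℕ i
      above : ∀ j → row σ (top a j) ≢ r
      above j eq = <⇒≱ (row-< (D₁.columns a j) (D₁.valid a j) σ)
        (subst (m₁ ≤_) (trans (sym eq) (row-shiftLabel d σ (D₁.columns a j))) (m≤m+n m₁ _))

  stack : Design (m₁ + m₂) (n₁ + n₂) s c
  stack = record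
    { columns   = cols
    ; valid     = λ a → all-++ (Valid (m₁ + m₂)) (top a) (bottom a)
                    (λ j → valid-mono (top a j) (m≤m+n m₁ m₂) (D₁.valid a j))
                    (λ j → valid-shiftRows m₁ (D₂.columns a j) (D₂.valid a j))
    ; numbering = numbering-beside D₁.columns bottom D₁.numbering D₂.numbering
    ; row-count = λ a → ∀-split
        (λ i → trans (cong₂ _+_ (tally-top a hi (const 1) i) (tally-top a lo (const 1) i)) (D₁.row-count a i))
        (λ i → trans (cong₂ _+_ (tally-bottom a hi (const 1) i) (tally-bottom a lo (const 1) i)) (D₂.row-count a i))
    ; row-mass  = λ a → ∀-split
        (λ i → trans (tally-top a hi weight i)
                 (trans (mass-shiftLabel-balanced d (toℕ i) (D₁.columns a) (bal₁ a i) (D₁.row-mass a i))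
                        (sym (tally-top a lo weight i))))
        (λ i → trans (tally-bottom a hi weight i) (trans (D₂.row-mass a i) (sym (tally-bottom a lo weight i))))
    }

  stack-balanced : Balanced D₂ → Balanced stack
  stack-balanced bal₂ a = ∀-split
    (λ i → trans (tally-top a hi (const 1) i) (trans (bal₁ a i) (sym (tally-top a lo (const 1) i))))
    (λ i → trans (tally-bottom a hi (const 1) i) (trans (bal₂ a i) (sym (tally-bottom a lo (const 1) i))))

unionᵇ : ∀ {m n s c₁ c₂} → BalancedDesign m n s c₁ → BalancedDesign m n s c₂ → BalancedDesign m n s (c₁ + c₂)
unionᵇ B₁ (D₂ , bal₂) = union B₁ D₂ , union-balanced B₁ D₂ bal₂

stackᵇ : ∀ {m₁ m₂ n₁ n₂ s c} → BalancedDesign m₁ n₁ s c → BalancedDesign m₂ n₂ s c →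
         BalancedDesign (m₁ + m₂) (n₁ + n₂) s c
stackᵇ B₁ (D₂ , bal₂) = stack B₁ D₂ , stack-balanced B₁ D₂ bal₂

copies : ∀ {m n s} → BalancedDesign m n s 1 → ∀ c → BalancedDesign m n s c
copies B zero    = noArrays
copies B (suc c) = unionᵇ B (copies B c)

-- Designs checked by evaluation

module _ {k} (ℓ : Fin k → ℕ) where

  NumberingCheck : Set
  NumberingCheck = (∀ x → ℓ x < k) × (∀ x y → ℓ x ≡ ℓ y → x ≡ y) × (∀ (g : Fin k) → ∃[ x ] ℓ x ≡ toℕ g)

  numbering-check? : Dec NumberingCheck
  numbering-check? = all? (λ x → ℓ x <? k)
               ×-dec all? (λ x → all? λ y → (ℓ x ≟ ℓ y) →-dec (x Fin.≟ y))
               ×-dec all? (λ g → any? λ x → ℓ x ≟ toℕ g)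

  numbering-fromCheck : NumberingCheck → IsNumbering k ℓ
  numbering-fromCheck (bounded , injective , onto) = record
    { bounded    = bounded
    ; injective  = injective _ _
    ; surjective = λ g g<k → let x , ℓx≡ = onto (Fin.fromℕ< g<k) in x , trans ℓx≡ (Fin.toℕ-fromℕ< g<k)
    }

module Table (m n s c : ℕ) (table : Vec Column (c * n)) where

  -- Array a consists of the entries a * n, …, a * n + n - 1 of the table.
  columns : Fin c → Vector Column n
  columns a j = lookup table (combine a j)

  valid? : ∀ x → Dec (Valid m x)
  valid? x = hiRow x <? m ×-dec loRow x <? m ×-dec ¬? (hiRow x ≟ loRow x)

  Checks : Set
  Checks = (∀ a j → Valid m (columns a j))
         × NumberingCheck (label ∘ lookup table)
         × (∀ a (i : Fin m) → RowCount s (toℕ i) (columns a))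
         × (∀ a (i : Fin m) → RowMass (toℕ i) (columns a))

  checks? : Dec Checks
  checks? = all? (λ a → all? λ j → valid? (columns a j))
      ×-dec numbering-check? (label ∘ lookup table)
      ×-dec all? (λ a → all? λ i → count hi (toℕ i) (columns a) + count lo (toℕ i) (columns a) ≟ s)
      ×-dec all? (λ a → all? λ i → mass hi (toℕ i) (columns a) ≟ mass lo (toℕ i) (columns a))

  design : True checks? → Design m n s c
  design ok = record
    { columns   = columns
    ; valid     = proj₁ checked
    ; numbering = numbering-↔ (↔-sym *↔×) (numbering-fromCheck (label ∘ lookup table) (proj₁ (proj₂ checked)))
    ; row-count = proj₁ (proj₂ (proj₂ checked))
    ; row-mass  = proj₂ (proj₂ (proj₂ checked))
    }
    where checked = toWitness ok

  balanced? : Dec (∀ a (i : Fin m) → RowBalanced (toℕ i) (columns a))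
  balanced? = all? λ a → all? λ i → count hi (toℕ i) (columns a) ≟ count lo (toℕ i) (columns a)

  balancedDesign : True checks? → True balanced? → BalancedDesign m n s c
  balancedDesign ok bal = design ok , toWitness bal

numbered : ∀ {k} → Vec (ℕ × ℕ) k → Vec Column k
numbered rows = tabulate λ x → let h , l = lookup rows x in column (toℕ x) h l

design-2×4 : BalancedDesign 2 4 4 1
design-2×4 = Table.balancedDesign 2 4 4 1 table tt tt
  where table = numbered ((0 , 1) ∷ (1 , 0) ∷ (1 , 0) ∷ (0 , 1) ∷ [])

design-3×6 : BalancedDesign 3 6 4 1
design-3×6 = Table.balancedDesign 3 6 4 1 table tt tt
  where table = numbered ((0 , 1) ∷ (1 , 0) ∷ (1 , 2) ∷ (2 , 1) ∷ (2 , 0) ∷ (0 , 2) ∷ [])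

design-3×9 : BalancedDesign 3 9 6 1
design-3×9 = Table.balancedDesign 3 9 6 1 table tt tt
  where table = numbered ((0 , 2) ∷ (2 , 0) ∷ (2 , 1) ∷ (1 , 0) ∷ (1 , 2) ∷ (0 , 2) ∷ (2 , 1) ∷ (0 , 1) ∷ (1 , 0) ∷ [])

design-4×12 : BalancedDesign 4 12 6 1
design-4×12 = Table.balancedDesign 4 12 6 1 table tt tt
  where table = numbered ((0 , 2) ∷ (2 , 1) ∷ (3 , 0) ∷ (1 , 3) ∷ (3 , 0) ∷ (0 , 3) ∷
                          (2 , 0) ∷ (0 , 3) ∷ (1 , 2) ∷ (3 , 1) ∷ (1 , 2) ∷ (2 , 1) ∷ [])

design-5×15 : BalancedDesign 5 15 6 1
design-5×15 = Table.balancedDesign 5 15 6 1 table tt tt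
  where table = numbered ((0 , 1) ∷ (3 , 0) ∷ (1 , 4) ∷ (4 , 3) ∷ (4 , 0) ∷ (2 , 1) ∷ (1 , 2) ∷ (1 , 4) ∷
                          (0 , 4) ∷ (0 , 2) ∷ (4 , 1) ∷ (2 , 3) ∷ (3 , 0) ∷ (2 , 3) ∷ (3 , 2) ∷ [])

design-2×6 : Design 2 6 6 1
design-2×6 = Table.design 2 6 6 1 (numbered ((0 , 1) ∷ (0 , 1) ∷ (0 , 1) ∷ (1 , 0) ∷ (0 , 1) ∷ (1 , 0) ∷ [])) tt

-- Each row of a balanced 2 × 6 array holds three large and three small entries, so its labels split
-- into two triples of equal weight; for the labels 0, …, 5 that weight would be 18, which is not a
-- sum of three odd numbers. The two arrays therefore exchange the labels 5 and 6.
design-2×6-pair : BalancedDesign 2 6 6 2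
design-2×6-pair = Table.balancedDesign 2 6 6 2 table tt tt
  where
  table = column 0 0 1 ∷ column 1 1 0 ∷ column 2 0 1 ∷ column 3 1 0 ∷ column 4 1 0 ∷ column 6 0 1 ∷
          column 5 0 1 ∷ column 7 1 0 ∷ column 8 1 0 ∷ column 9 0 1 ∷ column 10 1 0 ∷ column 11 0 1 ∷ []

-- Existence

designs-4 : ∀ m → 2 ≤ m → ∃[ n ] BalancedDesign m n 4 1
designs-4 1 (s≤s ())
designs-4 2 _ = 4 , design-2×4
designs-4 3 _ = 6 , design-3×6
designs-4 (suc (suc (suc (suc m)))) _ =
  let n , B = designs-4 (suc (suc m)) (s≤s (s≤s z≤n)) in 4 + n , stackᵇ design-2×4 B

designs-6 : ∀ m → 3 ≤ m → ∃[ n ] BalancedDesign m n 6 1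
designs-6 1 (s≤s ())
designs-6 2 (s≤s (s≤s ()))
designs-6 3 _ = 9 , design-3×9
designs-6 4 _ = 12 , design-4×12
designs-6 5 _ = 15 , design-5×15
designs-6 (suc (suc (suc (suc (suc (suc m)))))) _ =
  let n , B = designs-6 (suc (suc (suc m))) (s≤s (s≤s (s≤s z≤n))) in 9 + n , stackᵇ design-3×9 B

two-row-designs : ∀ c → Design 2 6 6 c
two-row-designs zero          = proj₁ noArrays
two-row-designs (suc zero)    = design-2×6
two-row-designs (suc (suc c)) = union design-2×6-pair (two-row-designs c)

designs : ∀ m k c → 2 ≤ m → 2 ≤ k → ∃[ n ] Design m n (k * 2) c
designs m 1 c _ (s≤s ())
designs m 2 c 2≤m _ = let n , B = designs-4 m 2≤m in n , proj₁ (copies B c)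
designs 1 3 c (s≤s ()) _
designs 2 3 c _ _ = 6 , two-row-designs c
designs (suc (suc (suc m))) 3 c _ _ =
  let n , B = designs-6 (suc (suc (suc m))) (s≤s (s≤s (s≤s z≤n))) in n , proj₁ (copies B c)
designs m (suc (suc (suc (suc k)))) c 2≤m _ =
  let n₁ , B = designs-4 m 2≤m
      n₂ , D = designs m (suc (suc k)) c 2≤m (s≤s (s≤s z≤n))
  in n₁ + n₂ , beside (copies B c) D

sufficiency : ∀ m n s c → 1 ≤ c → 2 ≤ m → m * s ≡ 2 * n → 4 ≤ s → 2 ∣ s → MRS m n s 2 c
sufficiency m n s c 1≤c 2≤m m*s≡2*n 4≤s (divides k refl) =
  let n′ , D = designs m k c 2≤m (*-cancelʳ-≤ 2 k 2 4≤s)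
      n′≡n   = *-cancelˡ-≡ n′ n 2 (trans (sym (width D (Fin.fromℕ< 1≤c))) m*s≡2*n)
  in subst (λ n → MRS m n s 2 c) n′≡n (toMRS D k refl)

-- Necessity

entries : ∀ {n} → (Fin n → Maybe ℕ) → List ℕ
entries {zero}  f = []
entries {suc n} f with f zero
... | just v  = v ∷ entries (f ∘ suc)
... | nothing = entries (f ∘ suc)

length-entries : ∀ {n} (f : Fin n → Maybe ℕ) → length (entries f) ≡ filledCount f
length-entries {zero}  f = refl
length-entries {suc n} f with f zero
... | just _  = cong suc (length-entries (f ∘ suc))
... | nothing = length-entries (f ∘ suc)

sum-entries : ∀ {n} (f : Fin n → Maybe ℕ) → sumᴸ (entries f) ≡ lineSum f
sum-entries {zero}  f = refl
sum-entries {suc n} f with f zero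
... | just v  = cong (v +_) (sum-entries (f ∘ suc))
... | nothing = sum-entries (f ∘ suc)

∈-entries⁺ : ∀ {n} (f : Fin n → Maybe ℕ) {j v} → f j ≡ just v → v ∈ entries f
∈-entries⁺ {suc n} f {zero} eq with f zero
∈-entries⁺ {suc n} f {zero} refl | just _ = here refl
∈-entries⁺ {suc n} f {suc j} eq with f zero
... | just _  = there (∈-entries⁺ (f ∘ suc) eq)
... | nothing = ∈-entries⁺ (f ∘ suc) eq

∈-entries⁻ : ∀ {n} (f : Fin n → Maybe ℕ) {v} → v ∈ entries f → ∃[ j ] f j ≡ just v
∈-entries⁻ {suc n} f v∈ with f zero in eq
∈-entries⁻ {suc n} f (here refl) | just _ = zero , eq
∈-entries⁻ {suc n} f (there v∈) | just _ = let j , eq′ = ∈-entries⁻ (f ∘ suc) v∈ in suc j , eq′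
∈-entries⁻ {suc n} f v∈ | nothing = let j , eq′ = ∈-entries⁻ (f ∘ suc) v∈ in suc j , eq′

filled-exists : ∀ {n k} (f : Fin n → Maybe ℕ) → filledCount f ≡ suc k → ∃[ j ] ∃[ v ] f j ≡ just v
filled-exists f count≡ with entries f | trans (length-entries f) count≡ | ∈-entries⁻ f
... | v ∷ _ | _ | position = let j , fj≡ = position (here refl) in j , v , fj≡

lineSum-single : ∀ {n} (f : Fin n → Maybe ℕ) → filledCount f ≡ 1 → ∀ {j u} → f j ≡ just u → lineSum f ≡ u
lineSum-single f count≡ fj≡ with entries f | trans (length-entries f) count≡ | sum-entries f | ∈-entries⁺ f fj≡
... | w ∷ [] | _ | sum≡ | here refl = trans (sym sum≡) (+-identityʳ w)
... | w ∷ [] | _ | _    | there ()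

lineSum-pair : ∀ {n} (f : Fin n → Maybe ℕ) → filledCount f ≡ 2 → ∀ {k u} → f k ≡ just u →
               ∃[ k′ ] ∃[ u′ ] k′ ≢ k × f k′ ≡ just u′ × lineSum f ≡ u + u′
lineSum-pair {suc n} f count≡ {zero} fk≡ with f zero | fk≡
... | just u | refl =
  let j , u′ , rest-j≡ = filled-exists (f ∘ suc) (suc-injective count≡)
  in suc j , u′ , (λ ()) , rest-j≡ , cong (u +_) (lineSum-single (f ∘ suc) (suc-injective count≡) rest-j≡)
lineSum-pair {suc n} f count≡ {suc k} {u} fk≡ with f zero in f0≡
... | just v  = zero , v , (λ ()) , f0≡ ,
                trans (cong (v +_) (lineSum-single (f ∘ suc) (suc-injective count≡) fk≡)) (+-comm v u)
... | nothing = let k′ , u′ , k′≢k , fk′≡ , sum≡ = lineSum-pair (f ∘ suc) count≡ fk≡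
                in suc k′ , u′ , k′≢k ∘ Fin.suc-injective , fk′≡ , sum≡

concatFin : ∀ {k} → (Fin k → List ℕ) → List ℕ
concatFin {zero}  F = []
concatFin {suc k} F = F zero ++ᴸ concatFin (F ∘ suc)

concatFin-hom : ∀ (g : List ℕ → ℕ) → g [] ≡ 0 → (∀ xs ys → g (xs ++ᴸ ys) ≡ g xs + g ys) →
                ∀ {k} (F : Fin k → List ℕ) → g (concatFin F) ≡ sum (g ∘ F)
concatFin-hom g g[] g++ {zero}  F = g[]
concatFin-hom g g[] g++ {suc k} F = trans (g++ (F zero) _) (cong (g (F zero) +_) (concatFin-hom g g[] g++ (F ∘ suc)))

∈-concatFin : ∀ {k} (F : Fin k → List ℕ) i {v} → v ∈ F i → v ∈ concatFin F
∈-concatFin F zero    v∈ = ∈-++⁺ˡ v∈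
∈-concatFin F (suc i) v∈ = ∈-++⁺ʳ (F zero) (∈-concatFin (F ∘ suc) i v∈)

sum-covering : ∀ k (L : List ℕ) → length L ≡ k → (∀ v → 1 ≤ v → v ≤ k → v ∈ L) → sumᴸ L * 2 ≡ k * suc k
sum-covering zero    []      _     _      = refl
sum-covering (suc k) L len≡ covers with ∈-∃++ (covers (suc k) (s≤s z≤n) ≤-refl)
... | ys , zs , refl = begin
  sumᴸ (ys ++ᴸ suc k ∷ zs) * 2            ≡⟨ cong (_* 2) sum≡ ⟩
  (suc k + sumᴸ (ys ++ᴸ zs)) * 2          ≡⟨ *-distribʳ-+ 2 (suc k) _ ⟩
  suc k * 2 + sumᴸ (ys ++ᴸ zs) * 2        ≡⟨ cong (suc k * 2 +_) (sum-covering k (ys ++ᴸ zs) len′ covers′) ⟩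
  suc k * 2 + k * suc k                   ≡⟨ triangle k ⟩
  suc k * suc (suc k)                     ∎
  where
  open ≡-Reasoning
  triangle : ∀ k → suc k * 2 + k * suc k ≡ suc k * suc (suc k)
  triangle = solve-∀

  sum≡ : sumᴸ (ys ++ᴸ suc k ∷ zs) ≡ suc k + sumᴸ (ys ++ᴸ zs)
  sum≡ = begin
    sumᴸ (ys ++ᴸ suc k ∷ zs)              ≡⟨ sumᴸ-++ ys (suc k ∷ zs) ⟩
    sumᴸ ys + (suc k + sumᴸ zs)           ≡⟨ +-comm (sumᴸ ys) _ ⟩
    suc k + sumᴸ zs + sumᴸ ys             ≡⟨ +-assoc (suc k) _ _ ⟩
    suc k + (sumᴸ zs + sumᴸ ys)           ≡⟨ cong (suc k +_) (trans (+-comm _ (sumᴸ ys)) (sym (sumᴸ-++ ys zs))) ⟩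
    suc k + sumᴸ (ys ++ᴸ zs)              ∎

  len′ : length (ys ++ᴸ zs) ≡ k
  len′ = trans (length-++ ys) (suc-injective (trans (sym (+-suc (length ys) (length zs)))
                                             (trans (sym (length-++ ys)) len≡)))

  covers′ : ∀ v → 1 ≤ v → v ≤ k → v ∈ ys ++ᴸ zs
  covers′ v 1≤v v≤k with ∈-++⁻ ys (covers v 1≤v (m≤n⇒m≤1+n v≤k))
  ... | inj₁ v∈ys         = ∈-++⁺ˡ v∈ys
  ... | inj₂ (here refl)  = ⊥-elim (<-irrefl refl (s≤s v≤k))
  ... | inj₂ (there v∈zs) = ∈-++⁺ʳ ys v∈zs

total-sum : ∀ {c r t N p q} (F : Fin c → Fin r → Fin t → Maybe ℕ) →
            (∀ a i → filledCount (F a i) ≡ p) → (∀ a i → lineSum (F a i) ≡ q) → c * (r * p) ≡ N →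
            (∀ v → 1 ≤ v → v ≤ N → ∃[ a ] ∃[ i ] ∃[ j ] F a i j ≡ just v) →
            c * (r * q) * 2 ≡ N * suc N
total-sum {c} {r} {_} {N} {p} {q} F count≡ sum≡ size≡ covers =
  trans (cong (_* 2) (sym total)) (sum-covering N L (trans size size≡) covered)
  where
  L = concatFin λ a → concatFin λ i → entries (F a i)

  measure : ∀ (g : List ℕ → ℕ) → g [] ≡ 0 → (∀ xs ys → g (xs ++ᴸ ys) ≡ g xs + g ys) →
            ∀ {e} → (∀ a i → g (entries (F a i)) ≡ e) → g L ≡ c * (r * e)
  measure g g[] g++ {e} g≡ =
    trans (concatFin-hom g g[] g++ (λ a → concatFin λ i → entries (F a i)))
      (trans (sum-cong-≗ λ a → trans (concatFin-hom g g[] g++ (λ i → entries (F a i)))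
                                      (trans (sum-cong-≗ (g≡ a)) (sum-const r e)))
             (sum-const c (r * e)))

  size : length L ≡ c * (r * p)
  size = measure length refl (λ xs ys → length-++ xs) (λ a i → trans (length-entries (F a i)) (count≡ a i))

  total : sumᴸ L ≡ c * (r * q)
  total = measure sumᴸ refl sumᴸ-++ (λ a i → trans (sum-entries (F a i)) (sum≡ a i))

  covered : ∀ v → 1 ≤ v → v ≤ N → v ∈ L
  covered v 1≤v v≤N =
    let a , i , j , Faij≡ = covers v 1≤v v≤N
    in ∈-concatFin (λ a → concatFin λ i → entries (F a i)) a (∈-concatFin (λ i → entries (F a i)) i (∈-entries⁺ (F a i) Faij≡))

module _ {m n s c} (1≤m : 1 ≤ m) (1≤n : 1 ≤ n) (1≤c : 1 ≤ c) (m*s≡2*n : m * s ≡ 2 * n)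
         (M : MRS m n s 2 c) where
  open IsMRS (proj₂ M)
  private
    A = proj₁ M
    N = n * 2 * c
    x = proj₁ magic
    y = proj₁ (proj₂ magic)
    row-sum = proj₁ (proj₂ (proj₂ magic))
    col-sum = proj₂ (proj₂ (proj₂ magic))

    2∣N : 2 ∣ N
    2∣N = divides (n * c) (reorder n c)
      where
      reorder : ∀ n c → n * 2 * c ≡ n * c * 2
      reorder = solve-∀

    instance
      N-nonZero : NonZero N
      N-nonZero = >-nonZero (≤-trans (s≤s z≤n) (*-mono-≤ (*-mono-≤ 1≤n (≤-refl {2})) 1≤c))

    row-total : c * (m * x) * 2 ≡ N * suc N
    row-total = total-sum A row-filled row-sum (trans (cong (c *_) m*s≡2*n) (reorder c n)) each-appears
      where
      reorder : ∀ c n → c * (2 * n) ≡ n * 2 * c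
      reorder = solve-∀

    column-total : c * (n * y) * 2 ≡ N * suc N
    column-total = total-sum (λ a j i → A a i j) col-filled col-sum (*-comm c (n * 2))
      λ v 1≤v v≤N → let a , i , j , eq = each-appears v 1≤v v≤N in a , j , i , eq

  column-magic : y ≡ suc N
  column-magic = *-cancelˡ-≡ y (suc N) N (trans (reorder n c y) column-total)
    where
    reorder : ∀ n c y → n * 2 * c * y ≡ c * (n * y) * 2
    reorder = solve-∀

  row-magic : x * 2 ≡ s * suc N
  row-magic = *-cancelˡ-≡ (x * 2) (s * suc N) N (begin
    N * (x * 2)                 ≡⟨ reorder₁ n c x ⟩
    c * x * 2 * (2 * n)         ≡⟨ cong (c * x * 2 *_) m*s≡2*n ⟨
    c * x * 2 * (m * s)         ≡⟨ reorder₂ c x m s ⟩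
    s * (c * (m * x) * 2)       ≡⟨ cong (s *_) row-total ⟩
    s * (N * suc N)             ≡⟨ reorder₃ s N ⟩
    N * (s * suc N)             ∎)
    where
    open ≡-Reasoning
    reorder₁ : ∀ n c x → n * 2 * c * (x * 2) ≡ c * x * 2 * (2 * n)
    reorder₁ = solve-∀
    reorder₂ : ∀ c x m s → c * x * 2 * (m * s) ≡ s * (c * (m * x) * 2)
    reorder₂ = solve-∀
    reorder₃ : ∀ s N → s * (N * suc N) ≡ N * (s * suc N)
    reorder₃ = solve-∀

  even-row-length : 2 ∣ s
  even-row-length with euclidsLemma s (suc N) prime[2] (divides x (sym row-magic))
  ... | inj₁ 2∣s   = 2∣s
  ... | inj₂ 2∣1+N with () ← ∣1⇒≡1 (∣m+n∣m⇒∣n (subst (2 ∣_) (+-comm 1 N) 2∣1+N) 2∣N)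

  row-length≢2 : s ≢ 2
  row-length≢2 refl =
    let a₀ = Fin.fromℕ< 1≤c
        i₀ = Fin.fromℕ< 1≤m
        x≡y = *-cancelʳ-≡ x y 2 (trans row-magic (trans (*-comm 2 (suc N)) (cong (_* 2) (sym column-magic))))
        j₁ , v₁ , A₀j₁≡v₁ = filled-exists (A a₀ i₀) (row-filled a₀ i₀)
        j₂ , v₂ , _ , A₀j₂≡v₂ , row≡ = lineSum-pair (A a₀ i₀) (row-filled a₀ i₀) A₀j₁≡v₁
        i′ , u′ , i′≢i₀ , A′j₁≡u′ , column≡ = lineSum-pair (λ i → A a₀ i j₁) (col-filled a₀ j₁) A₀j₁≡v₁
        u′≡v₂ = +-cancelˡ-≡ v₁ u′ v₂ (trans (sym column≡) (trans (col-sum a₀ j₁)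
                  (trans (sym x≡y) (trans (sym (row-sum a₀ i₀)) row≡))))
    in i′≢i₀ (cong (proj₁ ∘ proj₂) (appears-once a₀ i′ j₁ a₀ i₀ j₂ v₂ (trans A′j₁≡u′ (cong just u′≡v₂)) A₀j₂≡v₂))

even-≥4 : ∀ {s} → 2 ∣ s → 2 ≤ s → s ≢ 2 → 4 ≤ s
even-≥4 (divides 0             refl) ()
even-≥4 (divides 1             refl) _ s≢2 = ⊥-elim (s≢2 refl)
even-≥4 (divides (suc (suc k)) refl) _ _   = s≤s (s≤s (s≤s (s≤s z≤n)))

at-least-two-rows : ∀ {m n s} → 1 ≤ n → s ≤ n → m * s ≡ 2 * n → 2 ≤ m
at-least-two-rows {m} {n} 1≤n s≤n m*s≡2*n =
  *-cancelʳ-≤ 2 m n {{>-nonZero 1≤n}} (subst (_≤ m * n) m*s≡2*n (*-monoʳ-≤ m s≤n))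

proposition3p3 : (m n s c : ℕ) → 1 ≤ m → 1 ≤ n → 1 ≤ c →
                 2 ≤ s → s ≤ n → m * s ≡ 2 * n →
                 (MRS m n s 2 c ⇔ (4 ≤ s × 2 ∣ s))
proposition3p3 m n s c 1≤m 1≤n 1≤c 2≤s s≤n m*s≡2*n = mk⇔
  (λ M → let 2∣s = even-row-length 1≤m 1≤n 1≤c m*s≡2*n M
         in even-≥4 2∣s 2≤s (row-length≢2 1≤m 1≤n 1≤c m*s≡2*n M) , 2∣s)
  (λ (4≤s , 2∣s) → sufficiency m n s c 1≤c (at-least-two-rows 1≤n s≤n m*s≡2*n) m*s≡2*n 4≤s 2∣s)
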